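{- Let $G$ be a graph with $|V(G)|=2^k$, where each vertex $u$ is assigned a distinct string $\mathrm{enc}(u)\in\{0,1\}^k$, and let $R[G]=(P,N)$ with $P=\{\mathrm{enc}(u)\,1\,\mathrm{enc}(u)^R : u\in V(G)\}$ and $N=\{\mathrm{enc}(u)\,1\,\mathrm{enc}(v)^R : uv\in E(G)\}$. Then any NFA consistent with $(P,N)$ has at least $\chi(G)$ states. Consequently $\mathrm{opt}_{DFA}(R[G])\geq \mathrm{opt}_{NFA}(R[G])\geq\chi(G)$.
   Context: $x^R$ is the reversal of $x$; edges are undirected. $\mathrm{opt}_{DFA}(R[G])$ and $\mathrm{opt}_{NFA}(R[G])$ denote the minimum numbers of states of a DFA, respectively an NFA, over $\{0,1\}$ that accepts all strings in $P$ and rejects all strings in $N$. $\chi(G)$ is the chromatic number. -}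

module Defs where

open import Data.Nat using (ℕ; _≤_; _^_)
open import Data.Bool using (Bool; true; false)
open import Data.Fin using (Fin)
open import Data.List using (List; []; _∷_; _++_; reverse)
open import Data.Vec using (Vec; toList)
open import Data.Product using (Σ; _×_; ∃; ∃-syntax)
open import Relation.Nullary using (¬_)
open import Relation.Binary.PropositionalEquality using (_≡_)
open import Level using (Level; suc; zero)

-- Strings over the alphabet {0,1}; false = 0, true = 1.
Word : Set
Word = List Bool

record Graph (m : ℕ) : Set₁ where
  field
    Adj       : Fin m → Fin m → Set
    symmetric : ∀ {u v} → Adj u v → Adj v u
    irreflex  : ∀ {u} → ¬ Adj u u

open Graph public

ProperColouring : ∀ {m} → Graph m → (c : ℕ) → (Fin m → Fin c) → Set
ProperColouring G c col = ∀ {u v} → Adj G u v → ¬ (col u ≡ col v)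

Colourable : ∀ {m} → Graph m → ℕ → Set
Colourable G c = Σ (_ → Fin c) (ProperColouring G c)

IsChromaticNumber : ∀ {m} → Graph m → ℕ → Set
IsChromaticNumber G χ = Colourable G χ × (∀ c → Colourable G c → χ ≤ c)

record Sample : Set₁ where
  field
    Pos : Word → Set
    Neg : Word → Set

open Sample public

record NFA (n : ℕ) : Set₁ where
  field
    start  : Fin n
    δ      : Fin n → Bool → Fin n → Set
    final  : Fin n → Set

data Run {n : ℕ} (A : NFA n) : Fin n → Word → Fin n → Set where
  done : ∀ {q} → Run A q [] q
  step : ∀ {q a q' w q''} → NFA.δ A q a q' → Run A q' w q'' → Run A q (a ∷ w) q''

NFAAccepts : ∀ {n} → NFA n → Word → Set
NFAAccepts A w = ∃[ q ] (Run A (NFA.start A) w q × NFA.final A q)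

NFAConsistent : ∀ {n} → NFA n → Sample → Set
NFAConsistent A S =
  (∀ w → Pos S w → NFAAccepts A w) × (∀ w → Neg S w → ¬ NFAAccepts A w)

record DFA (n : ℕ) : Set where
  field
    start : Fin n
    δ     : Fin n → Bool → Fin n
    final : Fin n → Bool

runDFA : ∀ {n} → DFA n → Fin n → Word → Fin n
runDFA D q []      = q
runDFA D q (a ∷ w) = runDFA D (DFA.δ D q a) w

DFAAccepts : ∀ {n} → DFA n → Word → Set
DFAAccepts D w = DFA.final D (runDFA D (DFA.start D) w) ≡ true

DFAConsistent : ∀ {n} → DFA n → Sample → Set
DFAConsistent D S =
  (∀ w → Pos S w → DFAAccepts D w) × (∀ w → Neg S w → ¬ DFAAccepts D w)

IsOptNFA : Sample → ℕ → Set₁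
IsOptNFA S m =
  (Σ (NFA m) λ A → NFAConsistent A S) × (∀ n (A : NFA n) → NFAConsistent A S → m ≤ n)

IsOptDFA : Sample → ℕ → Set
IsOptDFA S m =
  (Σ (DFA m) λ D → DFAConsistent D S) × (∀ n (D : DFA n) → DFAConsistent D S → m ≤ n)

encWord : ∀ {k m} → (Fin m → Vec Bool k) → Fin m → Fin m → Word
encWord enc u v = toList (enc u) ++ (true ∷ reverse (toList (enc v)))

R[_,_] : ∀ {k} → Graph (2 ^ k) → (Fin (2 ^ k) → Vec Bool k) → Sample
R[ G , enc ] = record
  { Pos = λ w → ∃[ u ] (w ≡ encWord enc u u)
  ; Neg = λ w → ∃[ u ] ∃[ v ] (Adj G u v × w ≡ encWord enc u v)
  }

-- An accepting run of an NFA on enc(u) 1 enc(u)^R passes, after the prefix enc(u), through some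
-- state q(u); take q(u) as the colour of u. If adjacent u, v shared a colour, gluing the first half
-- of the run for u to the second half of the run for v would accept the negative string
-- enc(u) 1 enc(v)^R. So every consistent NFA has at least χ(G) states, and reading a DFA as an NFA
-- gives opt_NFA ≤ opt_DFA.
module Submission where

open import Defs
open import Data.Nat using (ℕ; _≤_; _^_)
open import Data.Bool using (Bool; true)
open import Data.Fin using (Fin)
open import Data.Vec using (Vec; toList)
open import Data.List using ([]; _∷_; _++_; reverse)
open import Data.Product using (_×_; _,_; proj₁; ∃-syntax)
open import Function.Definitions using (Injective)
open import Relation.Nullary using (¬_)
open import Relation.Binary.PropositionalEquality using (_≡_; refl; sym; trans; cong; subst)

module _ {n : ℕ} (A : NFA n) where

  Run-++⁻ : ∀ {q q″} xs {ys} → Run A q (xs ++ ys) q″ → ∃[ q′ ] (Run A q xs q′ × Run A q′ ys q″)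
  Run-++⁻ []       r          = _ , done , r
  Run-++⁻ (x ∷ xs) (step d r) with Run-++⁻ xs r
  ... | q′ , r₁ , r₂ = q′ , step d r₁ , r₂

  Run-++⁺ : ∀ {q q′ q″ xs ys} → Run A q xs q′ → Run A q′ ys q″ → Run A q (xs ++ ys) q″
  Run-++⁺ done        r₂ = r₂
  Run-++⁺ (step d r₁) r₂ = step d (Run-++⁺ r₁ r₂)

  colourable-from-NFA : ∀ {m} (G : Graph m) (prefix suffix : Fin m → Word)
    → (∀ u → NFAAccepts A (prefix u ++ suffix u))
    → (∀ {u v} → Adj G u v → ¬ NFAAccepts A (prefix u ++ suffix v))
    → Colourable G n
  colourable-from-NFA {m} G prefix suffix accepts rejects = colour , proper
    where
    splitAt-prefix : ∀ u → ∃[ q ] (Run A (NFA.start A) (prefix u) q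
                       × ∃[ f ] (Run A q (suffix u) f × NFA.final A f))
    splitAt-prefix u with accepts u
    ... | f , r , final-f with Run-++⁻ (prefix u) r
    ... | q , r₁ , r₂ = q , r₁ , f , r₂ , final-f

    colour : Fin m → Fin n
    colour u = proj₁ (splitAt-prefix u)

    proper : ProperColouring G n colour
    proper {u} {v} uv same =
      let (_ , run-u , _)               = splitAt-prefix u
          (_ , _ , f , run-v , final-f) = splitAt-prefix v
      in rejects uv (f , Run-++⁺ run-u (subst (λ q → Run A q (suffix v) f) (sym same) run-v) , final-f)

module _ {n : ℕ} (D : DFA n) where

  DFA⇒NFA : NFA n
  DFA⇒NFA = record
    { start = DFA.start D
    ; δ     = λ q a q′ → DFA.δ D q a ≡ q′
    ; final = λ q → DFA.final D q ≡ true
    }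

  runDFA⇒Run : ∀ q w → Run DFA⇒NFA q w (runDFA D q w)
  runDFA⇒Run q []      = done
  runDFA⇒Run q (a ∷ w) = step refl (runDFA⇒Run _ w)

  Run⇒runDFA : ∀ {q w q′} → Run DFA⇒NFA q w q′ → runDFA D q w ≡ q′
  Run⇒runDFA done          = refl
  Run⇒runDFA (step refl r) = Run⇒runDFA r

  DFAConsistent⇒NFAConsistent : ∀ S → DFAConsistent D S → NFAConsistent DFA⇒NFA S
  DFAConsistent⇒NFAConsistent S (accepts , rejects) =
    (λ w pos → _ , runDFA⇒Run _ w , accepts w pos) ,
    (λ w neg (f , r , final-f) → rejects w neg (trans (cong (DFA.final D) (Run⇒runDFA r)) final-f))

optNFA≤optDFA : ∀ S {oD oN} → IsOptDFA S oD → IsOptNFA S oN → oN ≤ oD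
optNFA≤optDFA S ((D , consistent) , _) (_ , minimal) =
  minimal _ (DFA⇒NFA D) (DFAConsistent⇒NFAConsistent D S consistent)

χ≤states-of-consistent-NFA : ∀ k (G : Graph (2 ^ k)) (enc : Fin (2 ^ k) → Vec Bool k) {χ}
  → IsChromaticNumber G χ → ∀ n (A : NFA n) → NFAConsistent A R[ G , enc ] → χ ≤ n
χ≤states-of-consistent-NFA k G enc (_ , least) n A (accepts , rejects) =
  least n (colourable-from-NFA A G prefix suffix
            (λ u → accepts _ (u , refl))
            (λ {u} {v} uv → rejects _ (u , v , uv , refl)))
  where
  prefix suffix : Fin (2 ^ k) → Word
  prefix u = toList (enc u)
  suffix v = true ∷ reverse (toList (enc v))

corollary5p3 : (k : ℕ) (G : Graph (2 ^ k)) (enc : Fin (2 ^ k) → Vec Bool k)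
    → Injective _≡_ _≡_ enc
    → (χ : ℕ) → IsChromaticNumber G χ
    → ((n : ℕ) (A : NFA n) → NFAConsistent A R[ G , enc ] → χ ≤ n)
      × ((oD oN : ℕ) → IsOptDFA R[ G , enc ] oD → IsOptNFA R[ G , enc ] oN
         → (oN ≤ oD) × (χ ≤ oN))
corollary5p3 k G enc _ χ isχ =
  χ≤n ,
  λ oD oN optD optN@((A , consistent) , _) →
    optNFA≤optDFA R[ G , enc ] optD optN , χ≤n oN A consistent
  where
  χ≤n : (n : ℕ) (A : NFA n) → NFAConsistent A R[ G , enc ] → χ ≤ n
  χ≤n = χ≤states-of-consistent-NFA k G enc isχ
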